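{- Let $r\geq 13$ be an integer and let $G$ be an $r$-minimal graph. Let $uv$ be an edge of $G$. If $d_G(u)\leq \lfloor r/2\rfloor$, then $d_G(u)+d_G(v)\geq r+3$.
   Context: All graphs are finite, simple and undirected. A total $k$-coloring of a graph is a map from $V\cup E$ to $\{1,\dots,k\}$ assigning different colors to any two adjacent or incident elements. For an integer $r$, an $r$-minimal graph is a connected graph $G$ with maximum degree $\Delta(G)\leq r$ that has no total $(r+2)$-coloring, and that has the fewest edges among all connected graphs with maximum degree at most $r$ having no total $(r+2)$-coloring. $d_G(x)$ denotes the degree of $x$ in $G$. -}

module Defs where

open import Data.Nat using (ℕ; zero; suc; _+_; _≤_; _<ᵇ_)
open import Data.Fin using (Fin; zero; suc; toℕ)
open import Data.Bool using (Bool; true; false; T; _∧_; if_then_else_)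
open import Relation.Binary.PropositionalEquality using (_≡_; _≢_)
open import Relation.Nullary using (¬_)

sumFin : (n : ℕ) → (Fin n → ℕ) → ℕ
sumFin zero    f = 0
sumFin (suc n) f = f zero + sumFin n (λ i → f (suc i))

count : (n : ℕ) → (Fin n → Bool) → ℕ
count n p = sumFin n (λ i → if p i then 1 else 0)

record Graph : Set where
  field
    n      : ℕ
    adj    : Fin n → Fin n → Bool
    sym    : ∀ x y → adj x y ≡ adj y x
    irrefl : ∀ x → adj x x ≡ false

open Graph public

deg : (G : Graph) → Fin (n G) → ℕ
deg G x = count (n G) (λ y → adj G x y)

MaxDegLe : Graph → ℕ → Set
MaxDegLe G r = ∀ x → deg G x ≤ r

edgeCount : Graph → ℕ
edgeCount G = sumFin (n G) (λ x → count (n G) (λ y → adj G x y ∧ (toℕ x <ᵇ toℕ y)))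

data Reach (G : Graph) : Fin (n G) → Fin (n G) → Set where
  here : ∀ {x} → Reach G x x
  step : ∀ {x y z} → T (adj G x y) → Reach G y z → Reach G x z

Connected : Graph → Set
Connected G = ∀ x y → Reach G x y

record TotalColoring (G : Graph) (k : ℕ) : Set where
  field
    vcol    : Fin (n G) → Fin k
    ecol    : (x y : Fin (n G)) → T (adj G x y) → Fin k
    ecol-sym : ∀ x y (p : T (adj G x y)) (q : T (adj G y x)) → ecol x y p ≡ ecol y x q
    vv      : ∀ x y → T (adj G x y) → vcol x ≢ vcol y
    ve      : ∀ x y (p : T (adj G x y)) → vcol x ≢ ecol x y p
    ee      : ∀ x y z (p : T (adj G x y)) (q : T (adj G x z)) → y ≢ z → ecol x y p ≢ ecol x z q

Bad : ℕ → Graph → Set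
Bad r G = Connected G × MaxDegLe G r × ¬ TotalColoring G (r + 2)
  where open import Data.Product using (_×_)

RMinimal : ℕ → Graph → Set
RMinimal r G = Bad r G × (∀ (H : Graph) → Bad r H → edgeCount G ≤ edgeCount H)
  where open import Data.Product using (_×_)

module Submission where

-- Suppose d(u) ≤ ⌊r/2⌋ but d(u) + d(v) ≤ r + 2. Delete the edge uv if u and v have a common
-- neighbour, and contract it otherwise. Either way the smaller graph is connected, has maximum
-- degree at most r (the contracted vertex has degree d(u) + d(v) − 2) and fewer edges, so by
-- minimality it has a total (r+2)-colouring. Pulled back to G, this colours everything except
-- uv and u. The edge uv then sees at most d(u) + d(v) − 1 colours and afterwards the vertex u
-- sees at most 2 d(u) ≤ r colours, so both can be coloured with r + 2 colours: a contradiction.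

open import Defs hiding (sym)
open import Data.Nat using (ℕ; _≤_; _+_)
open import Data.Nat.DivMod using (_/_; m/n*n≤m)
open import Data.Bool using (T)
open import Data.Fin using (Fin)

open import Algebra.Properties.CommutativeMonoid.Sum as Sum using ()
open import Data.Bool using (Bool; true; false; _∧_; _∨_; not; if_then_else_)
open import Data.Bool.Properties using (T-≡; T-∨; T-irrelevant; ∧-comm; ∨-comm; ∧-zeroʳ)
open import Data.Fin using (zero; suc; toℕ; _≟_; punchIn; punchOut)
open import Data.Fin.Properties
  using (any?; toℕ-injective; punchIn-punchOut; punchOut-punchIn; punchOut-cong; punchInᵢ≢i)
open import Data.Nat using (zero; suc; _*_; _<_; _<ᵇ_; _≤?_; z≤n; s≤s; z<s)
open import Data.Nat.Properties hiding (_≟_)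
open import Data.Nat.Tactic.RingSolver using (solve-∀)
open import Data.Product using (∃; _×_; _,_; proj₁; proj₂)
open import Data.Sum using (_⊎_; inj₁; inj₂; [_,_])
open import Function using (_∘_; id; case_of_)
open import Function.Bundles using (Equivalence)
open import Relation.Binary.PropositionalEquality
  using (_≡_; _≢_; refl; sym; trans; cong; cong₂; subst; subst₂; ≢-sym; module ≡-Reasoning)
open import Relation.Nullary using (¬_; Dec; yes; no; does; contradiction; _×-dec_; _⊎-dec_)
open import Relation.Nullary.Decidable using (T?; dec-true; dec-false)

open Sum +-0-commutativeMonoid using (sum; sum-cong-≗; sum-remove; ∑-distrib-+; ∑-comm)

ind : Bool → ℕ
ind b = if b then 1 else 0

ind-∧ : ∀ a b → ind (a ∧ b) ≡ (if a then ind b else 0)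
ind-∧ true  b = refl
ind-∧ false b = refl

ind-∨ : ∀ a b → ind (a ∨ b) ≤ ind a + ind b
ind-∨ true  b = s≤s z≤n
ind-∨ false b = ≤-refl

ind-∧-≤ : ∀ a b → ind (a ∧ b) ≤ ind a
ind-∧-≤ true  true  = ≤-refl
ind-∧-≤ true  false = z≤n
ind-∧-≤ false b     = z≤n

ind-split : ∀ a b → ind a ≡ ind (a ∧ not b) + (if b then ind a else 0)
ind-split true  true  = refl
ind-split true  false = refl
ind-split false true  = refl
ind-split false false = refl

∧-∧-not : ∀ b c → b ∧ (c ∧ not b) ≡ false
∧-∧-not true  c = ∧-zeroʳ c
∧-∧-not false c = refl

T⇒≡true : ∀ {b} → T b → b ≡ true
T⇒≡true = Equivalence.to T-≡

T-∨-intro : ∀ {b c} → T b ⊎ T c → T (b ∨ c)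
T-∨-intro = Equivalence.from T-∨

T-∧-not : ∀ {b} {P : Set} (p? : Dec P) → T b → ¬ P → T (b ∧ not (does p?))
T-∧-not {true} (yes p) _ ¬p = ¬p p
T-∧-not {true} (no _)  _ _  = _

sumFin≡sum : ∀ n (f : Fin n → ℕ) → sumFin n f ≡ sum f
sumFin≡sum zero    f = refl
sumFin≡sum (suc n) f = cong (f zero +_) (sumFin≡sum n (f ∘ suc))

sumFin-cong : ∀ n {f g : Fin n → ℕ} → (∀ i → f i ≡ g i) → sumFin n f ≡ sumFin n g
sumFin-cong n {f} {g} f≗g =
  trans (sumFin≡sum n f) (trans (sum-cong-≗ f≗g) (sym (sumFin≡sum n g)))

sumFin-mono : ∀ n {f g : Fin n → ℕ} → (∀ i → f i ≤ g i) → sumFin n f ≤ sumFin n g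
sumFin-mono zero    f≤g = z≤n
sumFin-mono (suc n) f≤g = +-mono-≤ (f≤g zero) (sumFin-mono n (f≤g ∘ suc))

sumFin-zeros : ∀ n → sumFin n (λ _ → 0) ≡ 0
sumFin-zeros zero    = refl
sumFin-zeros (suc n) = sumFin-zeros n

sumFin-distrib-+ : ∀ n (f g : Fin n → ℕ) →
                   sumFin n (λ i → f i + g i) ≡ sumFin n f + sumFin n g
sumFin-distrib-+ n f g = begin
  sumFin n (λ i → f i + g i)  ≡⟨ sumFin≡sum n _ ⟩
  sum (λ i → f i + g i)       ≡⟨ ∑-distrib-+ f g ⟩
  sum f + sum g               ≡⟨ cong₂ _+_ (sumFin≡sum n f) (sumFin≡sum n g) ⟨
  sumFin n f + sumFin n g     ∎
  where open ≡-Reasoning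

sumFin-comm : ∀ m n (f : Fin m → Fin n → ℕ) →
              sumFin m (λ i → sumFin n (f i)) ≡ sumFin n (λ j → sumFin m (λ i → f i j))
sumFin-comm m n f = begin
  sumFin m (λ i → sumFin n (f i))          ≡⟨ sumFin≡sum m _ ⟩
  sum (λ i → sumFin n (f i))               ≡⟨ sum-cong-≗ (λ i → sumFin≡sum n (f i)) ⟩
  sum (λ i → sum (f i))                    ≡⟨ ∑-comm f ⟩
  sum (λ j → sum (λ i → f i j))            ≡⟨ sum-cong-≗ (λ j → sumFin≡sum m (λ i → f i j)) ⟨
  sum (λ j → sumFin m (λ i → f i j))       ≡⟨ sumFin≡sum n _ ⟨
  sumFin n (λ j → sumFin m (λ i → f i j))  ∎
  where open ≡-Reasoning

sumFin-remove : ∀ n (i : Fin (suc n)) (f : Fin (suc n) → ℕ) →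
                sumFin (suc n) f ≡ f i + sumFin n (f ∘ punchIn i)
sumFin-remove n i f = begin
  sumFin (suc n) f                ≡⟨ sumFin≡sum (suc n) f ⟩
  sum f                           ≡⟨ sum-remove f ⟩
  f i + sum (f ∘ punchIn i)       ≡⟨ cong (f i +_) (sumFin≡sum n _) ⟨
  f i + sumFin n (f ∘ punchIn i)  ∎
  where open ≡-Reasoning

sumFin-select : ∀ n (i : Fin n) (f : Fin n → ℕ) →
                sumFin n (λ j → if does (j ≟ i) then f j else 0) ≡ f i
sumFin-select (suc n) zero    f = trans (cong (f zero +_) (sumFin-zeros n)) (+-identityʳ (f zero))
sumFin-select (suc n) (suc i) f = sumFin-select n i (f ∘ suc)

≤-sumFin : ∀ n (f : Fin n → ℕ) i → f i ≤ sumFin n f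
≤-sumFin (suc n) f zero    = m≤m+n _ _
≤-sumFin (suc n) f (suc i) = ≤-trans (≤-sumFin n (f ∘ suc) i) (m≤n+m _ _)

+-≤-sumFin : ∀ n (f : Fin n → ℕ) {i j} → i ≢ j → f i + f j ≤ sumFin n f
+-≤-sumFin (suc n) f {i} {j} i≢j = begin
  f i + f j                       ≡⟨ cong (λ k → f i + f k) (punchIn-punchOut i≢j) ⟨
  f i + f (punchIn i _)           ≤⟨ +-monoʳ-≤ (f i) (≤-sumFin n (f ∘ punchIn i) _) ⟩
  f i + sumFin n (f ∘ punchIn i)  ≡⟨ sumFin-remove n i f ⟨
  sumFin (suc n) f                ∎
  where open ≤-Reasoning

sumFin<⇒∃≡0 : ∀ k (h : Fin k → ℕ) → sumFin k h < k → ∃ λ c → h c ≡ 0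
sumFin<⇒∃≡0 (suc k) h Σh<k with h zero in h₀
... | zero  = zero , h₀
... | suc a = let c , hc≡0 = sumFin<⇒∃≡0 k (h ∘ suc) (≤-trans (s≤s (m≤n+m _ a)) (≤-pred Σh<k))
              in  suc c , hc≡0

-- Counting and free colours

_except_ : ∀ {n} → (Fin n → Bool) → Fin n → Fin n → Bool
(b except v) x = b x ∧ not (does (x ≟ v))

count-except : ∀ n (b : Fin n → Bool) v → count n b ≡ count n (b except v) + ind (b v)
count-except n b v = begin
  count n b
    ≡⟨ sumFin-cong n (λ x → ind-split (b x) (does (x ≟ v))) ⟩
  sumFin n (λ x → ind ((b except v) x) + atV x)
    ≡⟨ sumFin-distrib-+ n _ _ ⟩
  count n (b except v) + sumFin n atV
    ≡⟨ cong (count n (b except v) +_) (sumFin-select n v (ind ∘ b)) ⟩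
  count n (b except v) + ind (b v)
    ∎
  where
  open ≡-Reasoning
  atV : Fin n → ℕ
  atV x = if does (x ≟ v) then ind (b x) else 0

count-∨ : ∀ n (p q : Fin n → Bool) → count n (λ x → p x ∨ q x) ≤ count n p + count n q
count-∨ n p q = ≤-trans (sumFin-mono n (λ x → ind-∨ (p x) (q x))) (≤-reflexive (sumFin-distrib-+ n _ _))

count-∧-≤ : ∀ n (p q : Fin n → Bool) → count n (λ x → p x ∧ q x) ≤ count n p
count-∧-≤ n p q = sumFin-mono n (λ x → ind-∧-≤ (p x) (q x))

count-single : ∀ n (i : Fin n) b → count n (λ j → does (j ≟ i) ∧ b) ≡ ind b
count-single n i b = trans (sumFin-cong n (λ j → ind-∧ (does (j ≟ i)) b)) (sumFin-select n i (λ _ → ind b))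

hits : ∀ {n k} → (Fin n → Bool) → (Fin n → Fin k) → Fin k → ℕ
hits {n} b f c = count n (λ x → b x ∧ does (c ≟ f x))

sumFin-hits : ∀ {n} k (b : Fin n → Bool) (f : Fin n → Fin k) → sumFin k (hits b f) ≡ count n b
sumFin-hits {n} k b f =
  trans (sumFin-comm k n (λ c x → ind (b x ∧ does (c ≟ f x)))) (sumFin-cong n hits-of)
  where
  hits-of : ∀ x → sumFin k (λ c → ind (b x ∧ does (c ≟ f x))) ≡ ind (b x)
  hits-of x with b x
  ... | true  = sumFin-select k (f x) (λ _ → 1)
  ... | false = sumFin-zeros k

Avoids : ∀ {n k} → (Fin n → Bool) → (Fin n → Fin k) → Fin k → Set
Avoids b f c = ∀ x → T (b x) → f x ≢ c

hits≡0⇒Avoids : ∀ {n k} (b : Fin n → Bool) (f : Fin n → Fin k) {c} → hits b f c ≡ 0 → Avoids b f c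
hits≡0⇒Avoids {n} b f {c} none x bx fx≡c = 1+n≢0 (n≤0⇒n≡0 (begin
  1                           ≡⟨ cong₂ (λ p q → ind (p ∧ q)) (T⇒≡true bx) (dec-true (c ≟ f x) (sym fx≡c)) ⟨
  ind (b x ∧ does (c ≟ f x))  ≤⟨ ≤-sumFin n _ x ⟩
  hits b f c                  ≡⟨ none ⟩
  0                           ∎))
  where open ≤-Reasoning

free-colour : ∀ {n k} (b₁ b₂ : Fin n → Bool) (f₁ f₂ : Fin n → Fin k) (g : Fin k) →
              count n b₁ + count n b₂ + 1 < k →
              ∃ λ c → Avoids b₁ f₁ c × Avoids b₂ f₂ c × g ≢ c
free-colour {n} {k} b₁ b₂ f₁ f₂ g few =
  c , hits≡0⇒Avoids b₁ f₁ h₁≡0 , hits≡0⇒Avoids b₂ f₂ h₂≡0 , g≢c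
  where
  forbidden : Fin k → ℕ
  forbidden c = hits b₁ f₁ c + hits b₂ f₂ c + ind (does (c ≟ g))

  total : sumFin k forbidden ≡ count n b₁ + count n b₂ + 1
  total = begin
    sumFin k forbidden
      ≡⟨ sumFin-distrib-+ k _ _ ⟩
    sumFin k (λ c → hits b₁ f₁ c + hits b₂ f₂ c) + sumFin k (λ c → ind (does (c ≟ g)))
      ≡⟨ cong₂ _+_ (sumFin-distrib-+ k _ _) (sumFin-select k g (λ _ → 1)) ⟩
    sumFin k (hits b₁ f₁) + sumFin k (hits b₂ f₂) + 1
      ≡⟨ cong (_+ 1) (cong₂ _+_ (sumFin-hits k b₁ f₁) (sumFin-hits k b₂ f₂)) ⟩
    count n b₁ + count n b₂ + 1
      ∎
    where open ≡-Reasoning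

  free : ∃ λ c → forbidden c ≡ 0
  free = sumFin<⇒∃≡0 k forbidden (subst (_< k) (sym total) few)

  c : Fin k
  c = proj₁ free

  h₁₂≡0 : hits b₁ f₁ c + hits b₂ f₂ c ≡ 0
  h₁₂≡0 = m+n≡0⇒m≡0 _ (proj₂ free)

  h₁≡0 : hits b₁ f₁ c ≡ 0
  h₁≡0 = m+n≡0⇒m≡0 _ h₁₂≡0

  h₂≡0 : hits b₂ f₂ c ≡ 0
  h₂≡0 = m+n≡0⇒n≡0 _ h₁₂≡0

  g≢c : g ≢ c
  g≢c g≡c = 1+n≢0 (trans (cong ind (sym (dec-true (c ≟ g) (sym g≡c)))) (m+n≡0⇒n≡0 _ (proj₂ free)))

adj⇒≢ : ∀ (G : Graph) {x y} → T (adj G x y) → x ≢ y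
adj⇒≢ G {x} xy refl rewrite irrefl G x = xy

adj-sym : ∀ (G : Graph) {x y} → T (adj G x y) → T (adj G y x)
adj-sym G {x} {y} xy rewrite Graph.sym G x y = xy

deg-except : ∀ (G : Graph) {x y} → T (adj G x y) → deg G x ≡ count (n G) (adj G x except y) + 1
deg-except G {x} {y} xy =
  trans (count-except (n G) (adj G x) y) (cong (λ b → count (n G) (adj G x except y) + ind b) (T⇒≡true xy))

ind-<ᵇ-total : ∀ a b → a ≢ b → ind (a <ᵇ b) + ind (b <ᵇ a) ≡ 1
ind-<ᵇ-total zero    zero    a≢b = contradiction refl a≢b
ind-<ᵇ-total zero    (suc b) a≢b = refl
ind-<ᵇ-total (suc a) zero    a≢b = refl
ind-<ᵇ-total (suc a) (suc b) a≢b = ind-<ᵇ-total a b (a≢b ∘ cong suc)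

handshake : ∀ G → edgeCount G + edgeCount G ≡ sumFin (n G) (deg G)
handshake G = sym (begin
  sumFin N (deg G)
    ≡⟨ sumFin-cong N (λ x → trans (sumFin-cong N (split x)) (sumFin-distrib-+ N _ _)) ⟩
  sumFin N (λ x → count N (above x) + count N (below x))
    ≡⟨ sumFin-distrib-+ N _ _ ⟩
  edgeCount G + sumFin N (λ x → count N (below x))
    ≡⟨ cong (edgeCount G +_) (sumFin-comm N N _) ⟩
  edgeCount G + sumFin N (λ y → count N (λ x → below x y))
    ≡⟨ cong (edgeCount G +_) (sumFin-cong N λ y → sumFin-cong N λ x →
         cong (λ b → ind (b ∧ (toℕ y <ᵇ toℕ x))) (Graph.sym G x y)) ⟩
  edgeCount G + edgeCount G
    ∎)
  where
  open ≡-Reasoning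
  N : ℕ
  N = n G
  above below : Fin N → Fin N → Bool
  above x y = adj G x y ∧ (toℕ x <ᵇ toℕ y)
  below x y = adj G x y ∧ (toℕ y <ᵇ toℕ x)
  split : ∀ x y → ind (adj G x y) ≡ ind (above x y) + ind (below x y)
  split x y with adj G x y in xy
  ... | false = refl
  ... | true  = sym (ind-<ᵇ-total (toℕ x) (toℕ y) (adj⇒≢ G (subst T (sym xy) _) ∘ toℕ-injective))

edgeCount-< : ∀ G H → sumFin (n H) (deg H) + 2 ≤ sumFin (n G) (deg G) → edgeCount H < edgeCount G
edgeCount-< G H fewer = ≰⇒> λ eG≤eH → <⇒≱ (m<m+n (eH + eH) z<s) (begin
  eH + eH + 2               ≡⟨ cong (_+ 2) (handshake H) ⟩
  sumFin (n H) (deg H) + 2  ≤⟨ fewer ⟩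
  sumFin (n G) (deg G)      ≡⟨ handshake G ⟨
  eG + eG                   ≤⟨ +-mono-≤ eG≤eH eG≤eH ⟩
  eH + eH                   ∎)
  where
  open ≤-Reasoning
  eG eH : ℕ
  eG = edgeCount G
  eH = edgeCount H

-- Colourings around an edge uv

module AtEdge (G : Graph) {u v : Fin (n G)} (uv : T (adj G u v)) where

  u≢v : u ≢ v
  u≢v = adj⇒≢ G uv

  IsUV : Fin (n G) → Fin (n G) → Set
  IsUV x y = (x ≡ u × y ≡ v) ⊎ (x ≡ v × y ≡ u)

  isUV? : ∀ x y → Dec (IsUV x y)
  isUV? x y = (x ≟ u ×-dec y ≟ v) ⊎-dec (x ≟ v ×-dec y ≟ u)

  isUV : Fin (n G) → Fin (n G) → Bool
  isUV x y = does (isUV? x y)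

  IsUV-sym : ∀ {x y} → IsUV x y → IsUV y x
  IsUV-sym (inj₁ (x≡u , y≡v)) = inj₂ (y≡v , x≡u)
  IsUV-sym (inj₂ (x≡v , y≡u)) = inj₁ (y≡u , x≡v)

  isUV-sym : ∀ x y → isUV x y ≡ isUV y x
  isUV-sym x y =
    trans (∨-comm (does (x ≟ u) ∧ does (y ≟ v)) (does (x ≟ v) ∧ does (y ≟ u)))
          (cong₂ _∨_ (∧-comm (does (x ≟ v)) (does (y ≟ u))) (∧-comm (does (x ≟ u)) (does (y ≟ v))))

  IsUV-functional : ∀ {x y z} → IsUV x y → IsUV x z → y ≡ z
  IsUV-functional (inj₁ (refl , refl)) (inj₁ (_ , refl)) = refl
  IsUV-functional (inj₁ (refl , refl)) (inj₂ (u≡v , _))  = contradiction u≡v u≢v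
  IsUV-functional (inj₂ (refl , refl)) (inj₁ (v≡u , _))  = contradiction (sym v≡u) u≢v
  IsUV-functional (inj₂ (refl , refl)) (inj₂ (_ , refl)) = refl

  CommonNeighbour : Set
  CommonNeighbour = ∃ λ w → T (adj G u w) × T (adj G v w)

  -- A total colouring of G − uv in which the colour of u may clash with those of its
  -- neighbours; ecol is constrained only on the edges of G − uv.
  record PartialColouring (k : ℕ) : Set where
    field
      vcol     : Fin (n G) → Fin k
      ecol     : Fin (n G) → Fin (n G) → Fin k
      ecol-sym : ∀ {x y} → T (adj G x y) → ¬ IsUV x y → ecol x y ≡ ecol y x
      vv       : ∀ {x y} → T (adj G x y) → x ≢ u → y ≢ u → vcol x ≢ vcol y
      ve       : ∀ {x y} → T (adj G x y) → x ≢ u → ¬ IsUV x y → vcol x ≢ ecol x y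
      ee       : ∀ {x y z} → T (adj G x y) → T (adj G x z) → ¬ IsUV x y → ¬ IsUV x z →
                 y ≢ z → ecol x y ≢ ecol x z

  room-uv : ∀ {k} → deg G u + deg G v ≤ k →
            count (n G) (adj G u except v) + count (n G) (adj G v except u) + 1 < k
  room-uv {k} d[u]+d[v]≤k = begin
    1 + (count (n G) (adj G u except v) + count (n G) (adj G v except u) + 1)
      ≡⟨ arith (count (n G) (adj G u except v)) (count (n G) (adj G v except u)) ⟩
    (count (n G) (adj G u except v) + 1) + (count (n G) (adj G v except u) + 1)
      ≡⟨ cong₂ _+_ (deg-except G uv) (deg-except G (adj-sym G uv)) ⟨
    deg G u + deg G v
      ≤⟨ d[u]+d[v]≤k ⟩
    k ∎
    where
    open ≤-Reasoning
    arith : ∀ p q → 1 + (p + q + 1) ≡ (p + 1) + (q + 1)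
    arith = solve-∀

  room-u : ∀ {k} → deg G u + deg G u < k → count (n G) (adj G u except v) + deg G u + 1 < k
  room-u {k} 2d[u]<k = begin
    1 + (count (n G) (adj G u except v) + deg G u + 1)    ≡⟨ arith (count (n G) (adj G u except v)) (deg G u) ⟩
    1 + ((count (n G) (adj G u except v) + 1) + deg G u)  ≡⟨ cong (λ d → 1 + (d + deg G u)) (deg-except G uv) ⟨
    1 + (deg G u + deg G u)                               ≤⟨ 2d[u]<k ⟩
    k                                                     ∎
    where
    open ≤-Reasoning
    arith : ∀ p d → 1 + (p + d + 1) ≡ 1 + ((p + 1) + d)
    arith = solve-∀

  module _ {k} (P : PartialColouring k) where
    open PartialColouring P

    recolour : (c₁ c₂ : Fin k) →
               Avoids (adj G u except v) (ecol u) c₁ → Avoids (adj G v except u) (ecol v) c₁ →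
               vcol v ≢ c₁ →
               Avoids (adj G u except v) (ecol u) c₂ → Avoids (adj G u) vcol c₂ → c₁ ≢ c₂ →
               TotalColoring G k
    recolour c₁ c₂ c₁-u c₁-v c₁-vcol c₂-u c₂-vcol c₁≢c₂ = record
      { vcol = vcol′ ; ecol = λ x y _ → ecol′ x y ; ecol-sym = λ _ _ xy _ → ecol′-sym xy
      ; vv = λ _ _ → vv′ ; ve = λ _ _ → ve′ ; ee = λ _ _ _ → ee′ }
      where
      -- opaque, so that the case splits below cannot unfold these definitions
      opaque
        ecol′ : Fin (n G) → Fin (n G) → Fin k
        ecol′ x y = if isUV x y then c₁ else ecol x y

        vcol′ : Fin (n G) → Fin k
        vcol′ x = if does (x ≟ u) then c₂ else vcol x

        ecol′-uv : ∀ {x y} → IsUV x y → ecol′ x y ≡ c₁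
        ecol′-uv {x} {y} p rewrite dec-true (isUV? x y) p = refl

        ecol′-other : ∀ {x y} → ¬ IsUV x y → ecol′ x y ≡ ecol x y
        ecol′-other {x} {y} ¬p rewrite dec-false (isUV? x y) ¬p = refl

        vcol′-u : vcol′ u ≡ c₂
        vcol′-u rewrite dec-true (u ≟ u) refl = refl

        vcol′-other : ∀ {x} → x ≢ u → vcol′ x ≡ vcol x
        vcol′-other {x} x≢u rewrite dec-false (x ≟ u) x≢u = refl

      c₁-fresh : ∀ {x y z} → IsUV x y → T (adj G x z) → ¬ IsUV x z → c₁ ≢ ecol x z
      c₁-fresh (inj₁ (refl , refl)) uz ¬p =
        ≢-sym (c₁-u _ (T-∧-not (_ ≟ v) uz λ z≡v → ¬p (inj₁ (refl , z≡v))))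
      c₁-fresh (inj₂ (refl , refl)) vz ¬p =
        ≢-sym (c₁-v _ (T-∧-not (_ ≟ u) vz λ z≡u → ¬p (inj₂ (refl , z≡u))))

      ecol′-sym : ∀ {x y} → T (adj G x y) → ecol′ x y ≡ ecol′ y x
      ecol′-sym {x} {y} xy with isUV? x y
      ... | yes p = trans (ecol′-uv p) (sym (ecol′-uv (IsUV-sym p)))
      ... | no ¬p = begin
        ecol′ x y  ≡⟨ ecol′-other ¬p ⟩
        ecol x y   ≡⟨ ecol-sym xy ¬p ⟩
        ecol y x   ≡⟨ ecol′-other (¬p ∘ IsUV-sym) ⟨
        ecol′ y x  ∎
        where open ≡-Reasoning

      vv′ : ∀ {x y} → T (adj G x y) → vcol′ x ≢ vcol′ y
      vv′ {x} {y} xy with x ≟ u | y ≟ u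
      ... | yes refl | yes refl = contradiction refl (adj⇒≢ G xy)
      ... | yes refl | no y≢u rewrite vcol′-u | vcol′-other y≢u = ≢-sym (c₂-vcol y xy)
      ... | no x≢u | yes refl rewrite vcol′-u | vcol′-other x≢u = c₂-vcol x (adj-sym G xy)
      ... | no x≢u | no y≢u rewrite vcol′-other x≢u | vcol′-other y≢u = vv xy x≢u y≢u

      ve′ : ∀ {x y} → T (adj G x y) → vcol′ x ≢ ecol′ x y
      ve′ {x} {y} xy with x ≟ u | isUV? x y
      ... | yes refl | yes p rewrite vcol′-u | ecol′-uv p = ≢-sym c₁≢c₂
      ... | yes refl | no ¬p rewrite vcol′-u | ecol′-other ¬p =
        ≢-sym (c₂-u y (T-∧-not (y ≟ v) xy λ y≡v → ¬p (inj₁ (refl , y≡v))))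
      ... | no x≢u | yes (inj₁ (x≡u , _)) = contradiction x≡u x≢u
      ... | no x≢u | yes p@(inj₂ (refl , refl)) rewrite vcol′-other x≢u | ecol′-uv p = c₁-vcol
      ... | no x≢u | no ¬p rewrite vcol′-other x≢u | ecol′-other ¬p = ve xy x≢u ¬p

      ee′ : ∀ {x y z} → T (adj G x y) → T (adj G x z) → y ≢ z → ecol′ x y ≢ ecol′ x z
      ee′ {x} {y} {z} xy xz y≢z with isUV? x y | isUV? x z
      ... | yes p | yes q = contradiction (IsUV-functional p q) y≢z
      ... | yes p | no ¬q rewrite ecol′-uv p | ecol′-other ¬q = c₁-fresh p xz ¬q
      ... | no ¬p | yes q rewrite ecol′-other ¬p | ecol′-uv q = ≢-sym (c₁-fresh q xy ¬p)
      ... | no ¬p | no ¬q rewrite ecol′-other ¬p | ecol′-other ¬q = ee xy xz ¬p ¬q y≢z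

    -- uv sees d(u) − 1 + d(v) − 1 edge colours and the colour of v; then u sees d(u) vertex
    -- colours, d(u) − 1 edge colours and the new colour of uv.
    extend : deg G u + deg G v ≤ k → deg G u + deg G u < k → TotalColoring G k
    extend d[u]+d[v]≤k 2d[u]<k =
      let c₁ , c₁-u , c₁-v , c₁-vcol = free-colour (adj G u except v) (adj G v except u)
                                         (ecol u) (ecol v) (vcol v) (room-uv d[u]+d[v]≤k)
          c₂ , c₂-u , c₂-vcol , c₁≢c₂ = free-colour (adj G u except v) (adj G u)
                                         (ecol u) vcol c₁ (room-u 2d[u]<k)
      in  recolour c₁ c₂ c₁-u c₁-v c₁-vcol c₂-u c₂-vcol c₁≢c₂

  record LocallyInjectiveHom (H : Graph) : Set where
    field
      φ           : Fin (n G) → Fin (n H)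
      φ-adj       : ∀ {x y} → T (adj G x y) → ¬ IsUV x y → T (adj H (φ x) (φ y))
      φ-injective : ∀ {x y z} → T (adj G x y) → T (adj G x z) → ¬ IsUV x y → ¬ IsUV x z →
                    y ≢ z → φ y ≢ φ z

  pullback : ∀ {H k} → LocallyInjectiveHom H → TotalColoring H k → PartialColouring k
  pullback {H} {k} hom C = record
    { vcol     = vcol ∘ φ
    ; ecol     = ecolᴴ
    ; ecol-sym = λ {x} {y} xy ¬p → begin
        ecolᴴ x y                               ≡⟨ ecolᴴ-≡ (φ-adj xy ¬p) ⟩
        ecol (φ x) (φ y) (φ-adj xy ¬p)          ≡⟨ ecol-sym _ _ _ (φ-adj (adj-sym G xy) (¬p ∘ IsUV-sym)) ⟩
        ecol (φ y) (φ x) _                      ≡⟨ ecolᴴ-≡ _ ⟨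
        ecolᴴ y x                               ∎
    ; vv       = λ xy x≢u y≢u → vv _ _ (φ-adj xy (¬IsUV-off-u x≢u y≢u))
    ; ve       = λ xy _ ¬p → subst (_ ≢_) (sym (ecolᴴ-≡ (φ-adj xy ¬p))) (ve _ _ (φ-adj xy ¬p))
    ; ee       = λ xy xz ¬p ¬q y≢z →
                   subst₂ _≢_ (sym (ecolᴴ-≡ (φ-adj xy ¬p))) (sym (ecolᴴ-≡ (φ-adj xz ¬q)))
                     (ee _ _ _ _ _ (φ-injective xy xz ¬p ¬q y≢z))
    }
    where
    open ≡-Reasoning
    open LocallyInjectiveHom hom
    open TotalColoring C

    ¬IsUV-off-u : ∀ {x y} → x ≢ u → y ≢ u → ¬ IsUV x y
    ¬IsUV-off-u x≢u _   (inj₁ (x≡u , _)) = x≢u x≡u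
    ¬IsUV-off-u _   y≢u (inj₂ (_ , y≡u)) = y≢u y≡u

    -- the value on a non-edge of H is never used
    ecolᴴ : Fin (n G) → Fin (n G) → Fin k
    ecolᴴ x y with T? (adj H (φ x) (φ y))
    ... | yes φxφy = ecol (φ x) (φ y) φxφy
    ... | no _     = vcol (φ x)

    ecolᴴ-≡ : ∀ {x y} (φxφy : T (adj H (φ x) (φ y))) → ecolᴴ x y ≡ ecol (φ x) (φ y) φxφy
    ecolᴴ-≡ {x} {y} φxφy with T? (adj H (φ x) (φ y))
    ... | yes φxφy′ = cong (ecol (φ x) (φ y)) (T-irrelevant φxφy′ φxφy)
    ... | no ¬φxφy  = contradiction φxφy ¬φxφy

  record Reduction (r : ℕ) (H : Graph) : Set where
    field
      connected   : Connected H
      maxDeg      : MaxDegLe H r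
      fewer-edges : edgeCount H < edgeCount G
      hom         : LocallyInjectiveHom H

  reduction-impossible : ∀ {r H} → RMinimal r G → deg G u + deg G v ≤ r + 2 → deg G u ≤ r / 2 →
                         ¬ Reduction r H
  reduction-impossible {r} {H} ((_ , _ , uncolourable) , minimal) d[u]+d[v]≤r+2 d[u]≤r/2 red =
    <⇒≱ fewer-edges (minimal H (connected , maxDeg , λ C →
      uncolourable (extend (pullback hom C) d[u]+d[v]≤r+2 2d[u]<r+2)))
    where
    open Reduction red
    2d[u]<r+2 : deg G u + deg G u < r + 2
    2d[u]<r+2 = begin-strict
      deg G u + deg G u  ≤⟨ +-mono-≤ d[u]≤r/2 d[u]≤r/2 ⟩
      r / 2 + r / 2      ≡⟨ trans (*-comm (r / 2) 2) (cong (r / 2 +_) (+-identityʳ (r / 2))) ⟨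
      r / 2 * 2          ≤⟨ m/n*n≤m r 2 ⟩
      r                  <⟨ m<m+n r z<s ⟩
      r + 2              ∎
      where open ≤-Reasoning

  -- Deleting uv

  G∖uv : Graph
  G∖uv = record
    { n      = n G
    ; adj    = λ x y → adj G x y ∧ not (isUV x y)
    ; sym    = λ x y → cong₂ (λ p q → p ∧ not q) (Graph.sym G x y) (isUV-sym x y)
    ; irrefl = λ x → cong (λ p → p ∧ not (isUV x x)) (irrefl G x)
    }

  G∖uv-adj : ∀ {x y} → T (adj G x y) → ¬ IsUV x y → T (adj G∖uv x y)
  G∖uv-adj {x} {y} xy = T-∧-not (isUV? x y) xy

  G∖uv-maxDeg : ∀ {r} → MaxDegLe G r → MaxDegLe G∖uv r
  G∖uv-maxDeg maxDeg x = ≤-trans (count-∧-≤ (n G) (adj G x) _) (maxDeg x)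

  removed : Fin (n G) → ℕ
  removed x = sumFin (n G) (λ y → if isUV x y then ind (adj G x y) else 0)

  deg-G∖uv : ∀ x → deg G x ≡ deg G∖uv x + removed x
  deg-G∖uv x = trans (sumFin-cong (n G) (λ y → ind-split (adj G x y) (isUV x y))) (sumFin-distrib-+ (n G) _ _)

  1≤removed : ∀ {x y} → IsUV x y → T (adj G x y) → 1 ≤ removed x
  1≤removed {x} {y} p xy = begin
    1
      ≡⟨ cong₂ (λ b c → if b then ind c else 0) (dec-true (isUV? x y) p) (T⇒≡true xy) ⟨
    (if isUV x y then ind (adj G x y) else 0)
      ≤⟨ ≤-sumFin (n G) _ y ⟩
    removed x
      ∎
    where open ≤-Reasoning

  G∖uv-degreeSum : sumFin (n G) (deg G∖uv) + 2 ≤ sumFin (n G) (deg G)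
  G∖uv-degreeSum = begin
    sumFin N (deg G∖uv) + 2                        ≤⟨ +-monoʳ-≤ _ (+-mono-≤ removed-u removed-v) ⟩
    sumFin N (deg G∖uv) + (removed u + removed v)  ≤⟨ +-monoʳ-≤ _ (+-≤-sumFin N removed u≢v) ⟩
    sumFin N (deg G∖uv) + sumFin N removed         ≡⟨ sumFin-distrib-+ N _ _ ⟨
    sumFin N (λ x → deg G∖uv x + removed x)        ≡⟨ sumFin-cong N deg-G∖uv ⟨
    sumFin N (deg G)                               ∎
    where
    open ≤-Reasoning
    N : ℕ
    N = n G
    removed-u : 1 ≤ removed u
    removed-u = 1≤removed (inj₁ (refl , refl)) uv
    removed-v : 1 ≤ removed v
    removed-v = 1≤removed (inj₂ (refl , refl)) (adj-sym G uv)

  module _ {w} (uw : T (adj G u w)) (vw : T (adj G v w)) where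

    ¬IsUV-w : ∀ {x y} → x ≡ w ⊎ y ≡ w → ¬ IsUV x y
    ¬IsUV-w (inj₁ refl) (inj₁ (w≡u , _)) = adj⇒≢ G uw (sym w≡u)
    ¬IsUV-w (inj₁ refl) (inj₂ (w≡v , _)) = adj⇒≢ G vw (sym w≡v)
    ¬IsUV-w (inj₂ refl) (inj₁ (_ , w≡v)) = adj⇒≢ G vw (sym w≡v)
    ¬IsUV-w (inj₂ refl) (inj₂ (_ , w≡u)) = adj⇒≢ G uw (sym w≡u)

    G∖uv-walk : ∀ {x y} → Reach G x y → Reach G∖uv x y
    G∖uv-walk here = here
    G∖uv-walk (step {x} {y} xy rest) with isUV? x y
    ... | no ¬p = step (G∖uv-adj xy ¬p) (G∖uv-walk rest)
    ... | yes (inj₁ (refl , refl)) =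
      step (G∖uv-adj uw (¬IsUV-w (inj₂ refl)))
        (step (G∖uv-adj (adj-sym G vw) (¬IsUV-w (inj₁ refl))) (G∖uv-walk rest))
    ... | yes (inj₂ (refl , refl)) =
      step (G∖uv-adj vw (¬IsUV-w (inj₂ refl)))
        (step (G∖uv-adj (adj-sym G uw) (¬IsUV-w (inj₁ refl))) (G∖uv-walk rest))

  deletion : ∀ {r} → CommonNeighbour → Connected G → MaxDegLe G r → Reduction r G∖uv
  deletion (_ , uw , vw) connected maxDeg = record
    { connected   = λ x y → G∖uv-walk uw vw (connected x y)
    ; maxDeg      = G∖uv-maxDeg maxDeg
    ; fewer-edges = edgeCount-< G G∖uv G∖uv-degreeSum
    ; hom         = record { φ = id ; φ-adj = G∖uv-adj ; φ-injective = λ _ _ _ _ y≢z → y≢z }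
    }

-- Contracting uv: the vertices of G/uv are those of G other than u, numbered through
-- ι = punchIn u, and v′ (the vertex v) inherits the other neighbours of u.
module Contraction {m} (a : Fin (suc m) → Fin (suc m) → Bool)
  (a-sym : ∀ x y → a x y ≡ a y x) (a-irrefl : ∀ x → a x x ≡ false)
  {u v : Fin (suc m)} (uv : T (a u v)) where

  G : Graph
  G = record { n = suc m ; adj = a ; sym = a-sym ; irrefl = a-irrefl }

  open AtEdge G uv

  ι : Fin m → Fin (suc m)
  ι = punchIn u

  v′ : Fin m
  v′ = punchOut u≢v

  ι-v′ : ι v′ ≡ v
  ι-v′ = punchIn-punchOut u≢v

  moved : Fin m → Bool
  moved = (a u ∘ ι) except v′

  joined : Fin m → Fin m → Bool
  joined i j = does (i ≟ v′) ∧ moved j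

  G/uv : Graph
  G/uv = record
    { n      = m
    ; adj    = λ i j → a (ι i) (ι j) ∨ (joined i j ∨ joined j i)
    ; sym    = λ i j → cong₂ _∨_ (a-sym (ι i) (ι j)) (∨-comm (joined i j) (joined j i))
    ; irrefl = λ i →
        cong₂ (λ p q → p ∨ (q ∨ q)) (a-irrefl (ι i)) (∧-∧-not (does (i ≟ v′)) (a u (ι i)))
    }

  G/uv-adj-ι : ∀ {i j} → T (a (ι i) (ι j)) → T (adj G/uv i j)
  G/uv-adj-ι {i} {j} = T-∨-intro {a (ι i) (ι j)} ∘ inj₁

  G/uv-adj-joined : ∀ {i j} → T (joined i j) → T (adj G/uv i j)
  G/uv-adj-joined {i} {j} = T-∨-intro {a (ι i) (ι j)} ∘ inj₂ ∘ T-∨-intro {joined i j} ∘ inj₁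

  G/uv-adj-joinedᵒ : ∀ {i j} → T (joined j i) → T (adj G/uv i j)
  G/uv-adj-joinedᵒ {i} {j} = T-∨-intro {a (ι i) (ι j)} ∘ inj₂ ∘ T-∨-intro {joined i j} ∘ inj₂

  opaque
    φ : Fin (suc m) → Fin m
    φ x with x ≟ u
    ... | yes _   = v′
    ... | no x≢u  = punchOut (≢-sym x≢u)

    φ-u : φ u ≡ v′
    φ-u with u ≟ u
    ... | yes _   = refl
    ... | no u≢u  = contradiction refl u≢u

    ι-φ : ∀ {x} → x ≢ u → ι (φ x) ≡ x
    ι-φ {x} x≢u with x ≟ u
    ... | yes x≡u = contradiction x≡u x≢u
    ... | no _    = punchIn-punchOut _

    φ-ι : ∀ i → φ (ι i) ≡ i
    φ-ι i with ι i ≟ u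
    ... | yes ιi≡u = contradiction ιi≡u (punchInᵢ≢i u i)
    ... | no _     = trans (punchOut-cong u refl) (punchOut-punchIn u)

  φ-identifies-uv : ∀ {x y} → φ x ≡ φ y → x ≡ y ⊎ IsUV x y
  φ-identifies-uv {x} {y} φx≡φy with x ≟ u | y ≟ u
  ... | yes refl | yes refl = inj₁ refl
  ... | yes refl | no y≢u   = inj₂ (inj₁ (refl , (begin
    y          ≡⟨ ι-φ y≢u ⟨
    ι (φ y)    ≡⟨ cong ι (trans (sym φx≡φy) φ-u) ⟩
    ι v′       ≡⟨ ι-v′ ⟩
    v          ∎)))
    where open ≡-Reasoning
  ... | no x≢u   | yes refl = inj₂ (inj₂ ((begin
    x          ≡⟨ ι-φ x≢u ⟨
    ι (φ x)    ≡⟨ cong ι (trans φx≡φy φ-u) ⟩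
    ι v′       ≡⟨ ι-v′ ⟩
    v          ∎) , refl))
    where open ≡-Reasoning
  ... | no x≢u   | no y≢u   = inj₁ (trans (sym (ι-φ x≢u)) (trans (cong ι φx≡φy) (ι-φ y≢u)))

  joined-v′ : ∀ {y} → T (a u y) → y ≢ u → φ y ≢ v′ → T (joined v′ (φ y))
  joined-v′ {y} uy y≢u φy≢v′ rewrite dec-true (v′ ≟ v′) refl =
    T-∧-not (φ y ≟ v′) (subst (T ∘ a u) (sym (ι-φ y≢u)) uy) φy≢v′

  φ-adj-≢ : ∀ {x y} → T (a x y) → φ x ≢ φ y → T (adj G/uv (φ x) (φ y))
  φ-adj-≢ {x} {y} xy φx≢φy with x ≟ u | y ≟ u
  ... | yes refl | yes refl = contradiction refl (adj⇒≢ G xy)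
  ... | yes refl | no y≢u rewrite φ-u = G/uv-adj-joined (joined-v′ xy y≢u (φx≢φy ∘ sym))
  ... | no x≢u | yes refl rewrite φ-u = G/uv-adj-joinedᵒ (joined-v′ (adj-sym G xy) x≢u φx≢φy)
  ... | no x≢u | no y≢u = G/uv-adj-ι (subst₂ (λ p q → T (a p q)) (sym (ι-φ x≢u)) (sym (ι-φ y≢u)) xy)

  φ-adj : ∀ {x y} → T (a x y) → ¬ IsUV x y → T (adj G/uv (φ x) (φ y))
  φ-adj xy ¬p = φ-adj-≢ xy λ φx≡φy → [ adj⇒≢ G xy , ¬p ] (φ-identifies-uv φx≡φy)

  φ-walk : ∀ {x y} → Reach G x y → Reach G/uv (φ x) (φ y)
  φ-walk here = here
  φ-walk (step {x} {y} xy rest) with φ x ≟ φ y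
  ... | yes φx≡φy = subst (λ i → Reach G/uv i _) (sym φx≡φy) (φ-walk rest)
  ... | no φx≢φy  = step (φ-adj-≢ xy φx≢φy) (φ-walk rest)

  φ-injective : ¬ CommonNeighbour → ∀ {x y z} → T (a x y) → T (a x z) → y ≢ z → φ y ≢ φ z
  φ-injective noCommon {x} xy xz y≢z φy≡φz with φ-identifies-uv φy≡φz
  ... | inj₁ y≡z                  = y≢z y≡z
  ... | inj₂ (inj₁ (refl , refl)) = noCommon (x , adj-sym G xy , adj-sym G xz)
  ... | inj₂ (inj₂ (refl , refl)) = noCommon (x , adj-sym G xz , adj-sym G xy)

  deg∖u : Fin m → ℕ
  deg∖u i = count m (λ j → a (ι i) (ι j))

  a-u-v′ : a u (ι v′) ≡ true
  a-u-v′ = trans (cong (a u) ι-v′) (T⇒≡true uv)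

  deg-ι : ∀ i → deg G (ι i) ≡ ind (a u (ι i)) + deg∖u i
  deg-ι i = trans (sumFin-remove m u (ind ∘ a (ι i))) (cong (λ b → ind b + deg∖u i) (a-sym (ι i) u))

  deg-u : deg G u ≡ count m (a u ∘ ι)
  deg-u = trans (sumFin-remove m u (ind ∘ a u)) (cong (λ b → ind b + count m (a u ∘ ι)) (a-irrefl u))

  deg-u-moved : deg G u ≡ count m moved + 1
  deg-u-moved = trans deg-u (trans (count-except m (a u ∘ ι) v′) (cong (λ b → count m moved + ind b) a-u-v′))

  deg-v : deg G v ≡ 1 + deg∖u v′
  deg-v = trans (cong (deg G) (sym ι-v′)) (trans (deg-ι v′) (cong (λ b → ind b + deg∖u v′) a-u-v′))

  G/uv-deg-≤ : ∀ i → deg G/uv i ≤ deg∖u i + (count m (joined i) + ind (moved i))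
  G/uv-deg-≤ i = begin
    deg G/uv i
      ≤⟨ count-∨ m _ _ ⟩
    deg∖u i + count m (λ j → joined i j ∨ joined j i)
      ≤⟨ +-monoʳ-≤ (deg∖u i) (count-∨ m _ _) ⟩
    deg∖u i + (count m (joined i) + count m (λ j → joined j i))
      ≡⟨ cong (λ c → deg∖u i + (count m (joined i) + c)) (count-single m v′ (moved i)) ⟩
    deg∖u i + (count m (joined i) + ind (moved i))
      ∎
    where open ≤-Reasoning

  G/uv-deg-v′ : ∀ {r} → deg G u + deg G v ≤ r + 2 → deg G/uv v′ ≤ r
  G/uv-deg-v′ {r} d[u]+d[v]≤r+2 = +-cancelʳ-≤ 2 _ r (begin
    deg G/uv v′ + 2                                         ≤⟨ +-monoˡ-≤ 2 (G/uv-deg-≤ v′) ⟩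
    deg∖u v′ + (count m (joined v′) + ind (moved v′)) + 2   ≡⟨ cong₂ (λ p q → deg∖u v′ + (p + q) + 2)
                                                                       joined-v′-count moved-v′ ⟩
    deg∖u v′ + (count m moved + 0) + 2                      ≡⟨ arith (deg∖u v′) (count m moved) ⟩
    (count m moved + 1) + (1 + deg∖u v′)                    ≡⟨ cong₂ _+_ deg-u-moved deg-v ⟨
    deg G u + deg G v                                       ≤⟨ d[u]+d[v]≤r+2 ⟩
    r + 2                                                   ∎)
    where
    open ≤-Reasoning
    arith : ∀ o d → o + (d + 0) + 2 ≡ (d + 1) + (1 + o)
    arith = solve-∀
    joined-v′-count : count m (joined v′) ≡ count m moved
    joined-v′-count = sumFin-cong m (λ j → cong (λ b → ind (b ∧ moved j)) (dec-true (v′ ≟ v′) refl))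
    moved-v′ : ind (moved v′) ≡ 0
    moved-v′ = trans (cong (λ b → ind (a u (ι v′) ∧ not b)) (dec-true (v′ ≟ v′) refl))
                     (cong ind (∧-zeroʳ _))

  G/uv-deg-other : ∀ {i} → i ≢ v′ → deg G/uv i ≤ deg G (ι i)
  G/uv-deg-other {i} i≢v′ = begin
    deg G/uv i                                       ≤⟨ G/uv-deg-≤ i ⟩
    deg∖u i + (count m (joined i) + ind (moved i))   ≡⟨ cong (λ p → deg∖u i + (p + ind (moved i))) none ⟩
    deg∖u i + ind (moved i)                          ≤⟨ +-monoʳ-≤ (deg∖u i) (ind-∧-≤ _ _) ⟩
    deg∖u i + ind (a u (ι i))                        ≡⟨ trans (+-comm (deg∖u i) _) (sym (deg-ι i)) ⟩
    deg G (ι i)                                      ∎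
    where
    open ≤-Reasoning
    none : count m (joined i) ≡ 0
    none = trans (sumFin-cong m (λ j → cong (λ b → ind (b ∧ moved j)) (dec-false (i ≟ v′) i≢v′)))
                 (sumFin-zeros m)

  G/uv-maxDeg : ∀ {r} → MaxDegLe G r → deg G u + deg G v ≤ r + 2 → MaxDegLe G/uv r
  G/uv-maxDeg {r} maxDeg d[u]+d[v]≤r+2 i = case i ≟ v′ of λ where
    (yes i≡v′) → subst (λ j → deg G/uv j ≤ r) (sym i≡v′) (G/uv-deg-v′ d[u]+d[v]≤r+2)
    (no i≢v′)  → ≤-trans (G/uv-deg-other i≢v′) (maxDeg (ι i))

  G/uv-degreeSum : sumFin m (deg G/uv) + 2 ≤ sumFin (suc m) (deg G)
  G/uv-degreeSum = begin
    sumFin m (deg G/uv) + 2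
      ≤⟨ +-monoˡ-≤ 2 (sumFin-mono m G/uv-deg-≤) ⟩
    sumFin m (λ i → deg∖u i + (count m (joined i) + ind (moved i))) + 2
      ≡⟨ cong (_+ 2) (trans (sumFin-distrib-+ m _ _) (cong (Σdeg∖u +_) (sumFin-distrib-+ m _ _))) ⟩
    Σdeg∖u + (sumFin m (λ i → count m (joined i)) + D) + 2
      ≡⟨ cong (λ p → Σdeg∖u + (p + D) + 2) all-joined ⟩
    Σdeg∖u + (D + D) + 2
      ≡⟨ arith Σdeg∖u D ⟩
    (D + 1) + ((D + 1) + Σdeg∖u)
      ≡⟨ cong (λ p → p + (p + Σdeg∖u)) deg-u-moved ⟨
    deg G u + (deg G u + Σdeg∖u)
      ≡⟨ cong (λ p → deg G u + (p + Σdeg∖u)) deg-u ⟩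
    deg G u + (count m (a u ∘ ι) + Σdeg∖u)
      ≡⟨ cong (deg G u +_) (trans (sumFin-cong m deg-ι) (sumFin-distrib-+ m _ _)) ⟨
    deg G u + sumFin m (deg G ∘ ι)
      ≡⟨ sumFin-remove m u (deg G) ⟨
    sumFin (suc m) (deg G)
      ∎
    where
    open ≤-Reasoning
    Σdeg∖u D : ℕ
    Σdeg∖u = sumFin m deg∖u
    D = count m moved
    arith : ∀ o d → o + (d + d) + 2 ≡ (d + 1) + ((d + 1) + o)
    arith = solve-∀
    all-joined : sumFin m (λ i → count m (joined i)) ≡ D
    all-joined = trans (sumFin-comm m m (λ i j → ind (joined i j))) (sumFin-cong m (count-single m v′ ∘ moved))

  contraction : ∀ {r} → ¬ CommonNeighbour → Connected G → MaxDegLe G r →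
                deg G u + deg G v ≤ r + 2 → Reduction r G/uv
  contraction noCommon connected maxDeg d[u]+d[v]≤r+2 = record
    { connected   = λ i j → subst₂ (Reach G/uv) (φ-ι i) (φ-ι j) (φ-walk (connected (ι i) (ι j)))
    ; maxDeg      = G/uv-maxDeg maxDeg d[u]+d[v]≤r+2
    ; fewer-edges = edgeCount-< G G/uv G/uv-degreeSum
    ; hom         = record { φ = φ ; φ-adj = φ-adj ; φ-injective = λ xy xz _ _ → φ-injective noCommon xy xz }
    }

reduction : ∀ {r} (G : Graph) {u v} (uv : T (adj G u v)) → Connected G → MaxDegLe G r →
            deg G u + deg G v ≤ r + 2 → ∃ (AtEdge.Reduction G uv r)
reduction record { n = zero } {u = ()}
reduction G@record { n = suc _ } {u} {v} uv connected maxDeg d[u]+d[v]≤r+2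
  with any? (λ w → T? (adj G u w) ×-dec T? (adj G v w))
... | yes common  = _ , AtEdge.deletion G uv common connected maxDeg
... | no noCommon = _ , Contraction.contraction (adj G) (Graph.sym G) (irrefl G) uv
                          noCommon connected maxDeg d[u]+d[v]≤r+2

lemma2p1 : (r : ℕ) → 13 ≤ r → (G : Graph) → RMinimal r G →
    (u v : Fin (n G)) → T (adj G u v) → deg G u ≤ r / 2 →
    r + 3 ≤ deg G u + deg G v
lemma2p1 r _ G minimal@((connected , maxDeg , _) , _) u v uv d[u]≤r/2
  with r + 3 ≤? deg G u + deg G v
... | yes large = large
... | no ¬large = contradiction (proj₂ (reduction G uv connected maxDeg small))
                    (AtEdge.reduction-impossible G uv minimal small d[u]≤r/2)
  where
  small : deg G u + deg G v ≤ r + 2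
  small = ≤-pred (≤-trans (≰⇒> ¬large) (≤-reflexive (+-suc r 2)))
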